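{- For every integer $a\ge 3$, $$ n(a,a+3,a+4,a+5)=\begin{cases} \dfrac{a^2+7 a+20}{10}&\text{if } a\equiv 0\pmod 5,\\ \dfrac{a^2+7 a+12}{10}&\text{if } a\equiv 1\pmod 5,\\ \dfrac{a^2+7 a+12}{10}&\text{if } a\equiv 2\pmod 5,\\ \dfrac{a^2+7 a+10}{10}&\text{if } a\equiv 3\pmod 5,\\ \dfrac{a^2+7 a+16}{10}&\text{if } a\equiv 4\pmod 5. \end{cases} $$
   Context: For positive integers $a_1,\dots,a_m$ with $\gcd(a_1,\dots,a_m)=1$, the Sylvester number $n(a_1,\dots,a_m)$ is the number of positive integers that cannot be written as $x_1a_1+\cdots+x_ma_m$ with nonnegative integers $x_i$. -}

module Defs where

open import Data.Nat using (ℕ; _+_; _*_; _<_)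
open import Data.Vec using (Vec; zipWith; sum; toList)
open import Data.List using (List; length)
open import Data.List.Membership.Propositional using (_∈_)
open import Data.List.Relation.Unary.Unique.Propositional using (Unique)
open import Data.Product using (Σ; ∃; _×_)
open import Function.Bundles using (_⇔_)
open import Relation.Nullary using (¬_)
open import Relation.Binary.PropositionalEquality using (_≡_)

Representable : ∀ {m} → Vec ℕ m → ℕ → Set
Representable {m} as k = ∃ λ (xs : Vec ℕ m) → sum (zipWith _*_ xs as) ≡ k

SylvesterNumberIs : ∀ {m} → Vec ℕ m → ℕ → Set
SylvesterNumberIs as N =
  Σ (List ℕ) λ L →
    Unique L ×
    (∀ k → (k ∈ L) ⇔ (0 < k × ¬ Representable as k)) ×
    length L ≡ N

-- Every element of the semigroup is n·a + t, where t is a sum of n numbers from {0, 3, 4, 5}; such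
-- excesses t are exactly 0 and 3 ≤ t ≤ 5n. Hence i + j·a with 0 < i < a is representable iff
-- j ≥ ⌈i/5⌉ (for i ≥ 3), resp. j ≥ 1 + ⌈(a+i)/5⌉ (for i = 1, 2), since below that level its excess
-- would be i ∈ {1, 2} or too large. Summing these thresholds over the residues i gives the
-- number of gaps; it grows by a + 6 when a grows by 5, which yields the closed forms.
module Submission where

open import Defs
open import Data.Nat using (ℕ; zero; suc; _+_; _*_; _≤_; _<_; _/_; _%_; z≤n; s≤s; z<s; NonZero; _≟_)
open import Data.Nat.Properties
open import Data.Nat.DivMod using (m≡m%n+[m/n]*n; [m+kn]%n≡m%n; m<n⇒m%n≡m; m*n/n≡m; m%n<n)
open import Data.Nat.ListAction using (sum)
open import Data.Nat.Tactic.RingSolver using (solve-∀)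
open import Data.Vec using (Vec; _∷_; [])
open import Data.List as List using (List; _++_; upTo; downFrom; length)
open import Data.List.Properties using (length-++; length-map; length-upTo)
open import Data.List.Membership.Propositional using (_∈_)
open import Data.List.Membership.Propositional.Properties
  using (∈-++⁻; ∈-++⁺ˡ; ∈-++⁺ʳ; ∈-map⁺; ∈-map⁻; ∈-upTo⁺; ∈-upTo⁻)
open import Data.List.Relation.Unary.Unique.Propositional using (Unique)
open import Data.List.Relation.Unary.Unique.Propositional.Properties using (++⁺; map⁺; upTo⁺)
open import Data.List.Relation.Unary.AllPairs using ([])
open import Data.Product using (_×_; _,_; ∃; ∃₂; proj₂)
open import Data.Sum using (_⊎_; inj₁; inj₂)
open import Function.Bundles using (mk⇔)
open import Relation.Nullary using (¬_; yes; no)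
open import Relation.Binary.PropositionalEquality
  using (_≡_; refl; sym; trans; cong; cong₂; subst; module ≡-Reasoning)

⌈_/5⌉ : ℕ → ℕ
⌈ 0 /5⌉ = 0
⌈ 1 /5⌉ = 1
⌈ 2 /5⌉ = 1
⌈ 3 /5⌉ = 1
⌈ 4 /5⌉ = 1
⌈ 5 /5⌉ = 1
⌈ suc (suc (suc (suc (suc (suc n))))) /5⌉ = suc ⌈ suc n /5⌉

⌈/5⌉≤⇒≤*5 : ∀ n {j} → ⌈ n /5⌉ ≤ j → n ≤ j * 5
⌈/5⌉≤⇒≤*5 0 _ = z≤n
⌈/5⌉≤⇒≤*5 1 {suc j} _ = m≤n⇒m≤n+o (j * 5) (s≤s z≤n)
⌈/5⌉≤⇒≤*5 2 {suc j} _ = m≤n⇒m≤n+o (j * 5) (s≤s (s≤s z≤n))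
⌈/5⌉≤⇒≤*5 3 {suc j} _ = m≤n⇒m≤n+o (j * 5) (s≤s (s≤s (s≤s z≤n)))
⌈/5⌉≤⇒≤*5 4 {suc j} _ = m≤n⇒m≤n+o (j * 5) (s≤s (s≤s (s≤s (s≤s z≤n))))
⌈/5⌉≤⇒≤*5 5 {suc j} _ = m≤n⇒m≤n+o (j * 5) ≤-refl
⌈/5⌉≤⇒≤*5 (suc (suc (suc (suc (suc (suc n)))))) {suc j} (s≤s h) =
  s≤s (s≤s (s≤s (s≤s (s≤s (⌈/5⌉≤⇒≤*5 (suc n) h)))))

≤*5⇒⌈/5⌉≤ : ∀ n {j} → n ≤ j * 5 → ⌈ n /5⌉ ≤ j
≤*5⇒⌈/5⌉≤ 0 _ = z≤n
≤*5⇒⌈/5⌉≤ (suc n) {zero} ()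
≤*5⇒⌈/5⌉≤ 1 {suc j} _ = s≤s z≤n
≤*5⇒⌈/5⌉≤ 2 {suc j} _ = s≤s z≤n
≤*5⇒⌈/5⌉≤ 3 {suc j} _ = s≤s z≤n
≤*5⇒⌈/5⌉≤ 4 {suc j} _ = s≤s z≤n
≤*5⇒⌈/5⌉≤ 5 {suc j} _ = s≤s z≤n
≤*5⇒⌈/5⌉≤ (suc (suc (suc (suc (suc (suc n)))))) {suc j} (s≤s (s≤s (s≤s (s≤s (s≤s h))))) =
  s≤s (≤*5⇒⌈/5⌉≤ (suc n) h)

⌈5+n/5⌉≡1+⌈n/5⌉ : ∀ n → ⌈ 5 + n /5⌉ ≡ suc ⌈ n /5⌉
⌈5+n/5⌉≡1+⌈n/5⌉ zero    = refl
⌈5+n/5⌉≡1+⌈n/5⌉ (suc n) = refl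

⌈/5⌉-five-consecutive : ∀ n →
  ⌈ 4 + n /5⌉ + (⌈ 3 + n /5⌉ + (⌈ 2 + n /5⌉ + (⌈ 1 + n /5⌉ + ⌈ n /5⌉))) ≡ 4 + n
⌈/5⌉-five-consecutive 0 = refl
⌈/5⌉-five-consecutive 1 = refl
⌈/5⌉-five-consecutive 2 = refl
⌈/5⌉-five-consecutive 3 = refl
⌈/5⌉-five-consecutive 4 = refl
⌈/5⌉-five-consecutive (suc (suc (suc (suc (suc n))))) rewrite ⌈5+n/5⌉≡1+⌈n/5⌉ n =
  trans (sucs ⌈ 4 + n /5⌉ ⌈ 3 + n /5⌉ ⌈ 2 + n /5⌉ ⌈ 1 + n /5⌉ ⌈ n /5⌉)
        (cong (5 +_) (⌈/5⌉-five-consecutive n))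
  where
  sucs : ∀ x₄ x₃ x₂ x₁ x₀ →
    suc x₄ + (suc x₃ + (suc x₂ + (suc x₁ + suc x₀))) ≡ 5 + (x₄ + (x₃ + (x₂ + (x₁ + x₀))))
  sucs = solve-∀

gens : ℕ → Vec ℕ 4
gens a = a ∷ a + 3 ∷ a + 4 ∷ a + 5 ∷ []

-- x₀ is added last so that the size of a concrete combination n ∷ … computes.
size : Vec ℕ 4 → ℕ
size (x₀ ∷ x₁ ∷ x₂ ∷ x₃ ∷ []) = x₁ + x₂ + x₃ + x₀

excess : Vec ℕ 4 → ℕ
excess (x₀ ∷ x₁ ∷ x₂ ∷ x₃ ∷ []) = x₁ * 3 + x₂ * 4 + x₃ * 5

combination-gens : ∀ a xs → Data.Vec.sum (Data.Vec.zipWith _*_ xs (gens a)) ≡ excess xs + size xs * a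
combination-gens a (x₀ ∷ x₁ ∷ x₂ ∷ x₃ ∷ []) = normalise a x₀ x₁ x₂ x₃
  where
  normalise : ∀ a x₀ x₁ x₂ x₃ →
    x₀ * a + (x₁ * (a + 3) + (x₂ * (a + 4) + (x₃ * (a + 5) + 0)))
      ≡ x₁ * 3 + x₂ * 4 + x₃ * 5 + (x₁ + x₂ + x₃ + x₀) * a
  normalise = solve-∀

Admissible : ℕ → ℕ → Set
Admissible n t = t ≡ 0 ⊎ (3 ≤ t × t ≤ n * 5)

excess≤size*5 : ∀ xs → excess xs ≤ size xs * 5
excess≤size*5 (x₀ ∷ x₁ ∷ x₂ ∷ x₃ ∷ []) =
  ≤-trans (m≤m+n _ (x₀ * 5 + x₁ * 2 + x₂)) (≤-reflexive (expand x₀ x₁ x₂ x₃))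
  where
  expand : ∀ x₀ x₁ x₂ x₃ →
    x₁ * 3 + x₂ * 4 + x₃ * 5 + (x₀ * 5 + x₁ * 2 + x₂) ≡ (x₁ + x₂ + x₃ + x₀) * 5
  expand = solve-∀

excess-admissible : ∀ xs → Admissible (size xs) (excess xs)
excess-admissible (_ ∷ zero  ∷ zero  ∷ zero  ∷ []) = inj₁ refl
excess-admissible xs@(_ ∷ suc _ ∷ _     ∷ _     ∷ []) = inj₂ (s≤s (s≤s (s≤s z≤n)) , excess≤size*5 xs)
excess-admissible xs@(_ ∷ zero  ∷ suc _ ∷ _     ∷ []) = inj₂ (s≤s (s≤s (s≤s z≤n)) , excess≤size*5 xs)
excess-admissible xs@(_ ∷ zero  ∷ zero  ∷ suc _ ∷ []) = inj₂ (s≤s (s≤s (s≤s z≤n)) , excess≤size*5 xs)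

admissible-excess : ∀ n t → 3 ≤ t → t ≤ n * 5 → ∃ λ xs → size xs ≡ n × excess xs ≡ t
admissible-excess _ 0 () _
admissible-excess _ 1 (s≤s ()) _
admissible-excess _ 2 (s≤s (s≤s ())) _
admissible-excess zero (suc _) _ ()
admissible-excess (suc n) 3 _ _ = n ∷ 1 ∷ 0 ∷ 0 ∷ [] , refl , refl
admissible-excess (suc n) 4 _ _ = n ∷ 0 ∷ 1 ∷ 0 ∷ [] , refl , refl
admissible-excess (suc n) 5 _ _ = n ∷ 0 ∷ 0 ∷ 1 ∷ [] , refl , refl
admissible-excess 1 6 _ (s≤s (s≤s (s≤s (s≤s (s≤s ())))))
admissible-excess 1 7 _ (s≤s (s≤s (s≤s (s≤s (s≤s ())))))
admissible-excess (suc (suc n)) 6 _ _ = n ∷ 2 ∷ 0 ∷ 0 ∷ [] , refl , refl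
admissible-excess (suc (suc n)) 7 _ _ = n ∷ 1 ∷ 1 ∷ 0 ∷ [] , refl , refl
admissible-excess (suc n) (suc (suc (suc (suc (suc (suc (suc (suc t)))))))) _ (s≤s (s≤s (s≤s (s≤s (s≤s h)))))
  with admissible-excess n (3 + t) (s≤s (s≤s (s≤s z≤n))) h
... | (x₀ ∷ x₁ ∷ x₂ ∷ x₃ ∷ []) , refl , e =
  (x₀ ∷ x₁ ∷ x₂ ∷ suc x₃ ∷ []) , size-step x₀ x₁ x₂ x₃ , trans (excess-step x₁ x₂ x₃) (cong (5 +_) e)
  where
  size-step : ∀ x₀ x₁ x₂ x₃ → x₁ + x₂ + suc x₃ + x₀ ≡ suc (x₁ + x₂ + x₃ + x₀)
  size-step = solve-∀
  excess-step : ∀ x₁ x₂ x₃ → x₁ * 3 + x₂ * 4 + suc x₃ * 5 ≡ 5 + (x₁ * 3 + x₂ * 4 + x₃ * 5)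
  excess-step = solve-∀

admissible⇒representable : ∀ a {n t} → Admissible n t → Representable (gens a) (t + n * a)
admissible⇒representable a {n} (inj₁ refl) = n ∷ 0 ∷ 0 ∷ 0 ∷ [] , combination-gens a (n ∷ 0 ∷ 0 ∷ 0 ∷ [])
admissible⇒representable a {n} {t} (inj₂ (3≤t , t≤5n)) with admissible-excess n t 3≤t t≤5n
... | xs , refl , refl = xs , combination-gens a xs

representable⇒admissible : ∀ a {k} → Representable (gens a) k → ∃₂ λ n t → Admissible n t × t + n * a ≡ k
representable⇒admissible a (xs , eq) =
  size xs , excess xs , excess-admissible xs , trans (sym (combination-gens a xs)) eq

-- The number of gaps congruent to i modulo a, i.e. the least j with i + j·a representable.
gapCount : ℕ → ℕ → ℕ
gapCount a 0 = 0
gapCount a 1 = suc ⌈ 1 + a /5⌉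
gapCount a 2 = suc ⌈ 2 + a /5⌉
gapCount a (suc (suc (suc r))) = ⌈ 3 + r /5⌉

level≤ : ∀ {a i j n t} → i < a → t + n * a ≡ i + j * a → n ≤ j
level≤ {a} {i} {j} {n} {t} i<a eq = ≮⇒≥ λ j<n → <-irrefl (sym eq) (begin-strict
  i + j * a  <⟨ +-monoˡ-< (j * a) i<a ⟩
  a + j * a  ≤⟨ *-monoˡ-≤ a j<n ⟩
  n * a      ≤⟨ m≤n+m (n * a) t ⟩
  t + n * a  ∎)
  where open ≤-Reasoning

admissible-suc : ∀ {n t} → Admissible n (suc t) → 3 ≤ suc t × suc t ≤ n * 5
admissible-suc (inj₂ bounds) = bounds

admissible⇒⌈i+a/5⌉<n+d : ∀ a i {n d} → Admissible n (suc i + suc d * a) → ⌈ suc i + a /5⌉ < n + suc d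
admissible⇒⌈i+a/5⌉<n+d a i {n} {d} adm =
  ≤-trans (s≤s (≤*5⇒⌈/5⌉≤ (suc i + a)
                 (≤-trans (+-monoʳ-≤ (suc i) (m≤m+n a (d * a))) (proj₂ (admissible-suc {n} adm)))))
          (m<m+n n z<s)

admissible⇒gapCount≤ : ∀ {a} i {n d} → Admissible n (i + d * a) → gapCount a i ≤ n + d
admissible⇒gapCount≤ 0 _ = z≤n
admissible⇒gapCount≤ 1 {d = zero} (inj₂ (s≤s () , _))
admissible⇒gapCount≤ {a} 1 {d = suc _} adm = admissible⇒⌈i+a/5⌉<n+d a 0 adm
admissible⇒gapCount≤ 2 {d = zero} (inj₂ (s≤s (s≤s ()) , _))
admissible⇒gapCount≤ {a} 2 {d = suc _} adm = admissible⇒⌈i+a/5⌉<n+d a 1 adm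
admissible⇒gapCount≤ {a} i@(suc (suc (suc _))) {n} {d} adm =
  ≤*5⇒⌈/5⌉≤ i (≤-trans (m≤m+n i (d * a))
                (≤-trans (proj₂ (admissible-suc {n} adm)) (*-monoˡ-≤ 5 (m≤m+n n d))))

representable⇒gapCount≤ : ∀ a {i j} → i < a → Representable (gens a) (i + j * a) → gapCount a i ≤ j
representable⇒gapCount≤ a {i} {j} i<a rep with representable⇒admissible a rep
... | n , t , adm , eq with m≤n⇒∃[o]m+o≡n (level≤ {a} {i} {j} {n} {t} i<a eq)
...   | d , refl = admissible⇒gapCount≤ i {n} {d} (subst (Admissible n) t≡i+d*a adm)
  where
  shuffle : ∀ i n d a → i + (n + d) * a ≡ i + d * a + n * a
  shuffle = solve-∀
  t≡i+d*a : t ≡ i + d * a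
  t≡i+d*a = +-cancelʳ-≡ (n * a) t (i + d * a) (trans eq (shuffle i n d a))

gapCount≤⇒representable : ∀ a i {j} → i < a → gapCount a i ≤ j → Representable (gens a) (i + j * a)
gapCount≤⇒representable a 0 {j} _ _ = admissible⇒representable a {j} (inj₁ refl)
gapCount≤⇒representable a 1 {suc j} 1<a (s≤s h) =
  admissible⇒representable a {j} (inj₂ (s≤s 1<a , ⌈/5⌉≤⇒≤*5 (1 + a) h))
gapCount≤⇒representable a 2 {suc j} 2<a (s≤s h) =
  admissible⇒representable a {j} (inj₂ (≤-trans 2<a (m≤n+m a 2) , ⌈/5⌉≤⇒≤*5 (2 + a) h))
gapCount≤⇒representable a i@(suc (suc (suc _))) {j} _ h =
  admissible⇒representable a {j} (inj₂ (s≤s (s≤s (s≤s z≤n)) , ⌈/5⌉≤⇒≤*5 i h))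

staircase : ℕ → (ℕ → ℕ) → ℕ → List ℕ
staircase a h zero    = List.[]
staircase a h (suc r) = List.map (λ j → r + j * a) (upTo (h r)) ++ staircase a h r

∈-staircase⁺ : ∀ a h r {i j} → i < r → j < h i → i + j * a ∈ staircase a h r
∈-staircase⁺ a h (suc r) {i} {j} i<1+r j<hi with i ≟ r
... | yes refl = ∈-++⁺ˡ (∈-map⁺ (λ j → r + j * a) (∈-upTo⁺ j<hi))
... | no i≢r   = ∈-++⁺ʳ _ (∈-staircase⁺ a h r (≤∧≢⇒< (≤-pred i<1+r) i≢r) j<hi)

∈-staircase⁻ : ∀ a h r {k} → k ∈ staircase a h r → ∃₂ λ i j → i < r × j < h i × k ≡ i + j * a
∈-staircase⁻ a h (suc r) k∈ with ∈-++⁻ (List.map (λ j → r + j * a) (upTo (h r))) k∈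
... | inj₁ k∈row with ∈-map⁻ (λ j → r + j * a) k∈row
...   | j , j∈ , k≡ = r , j , ≤-refl , ∈-upTo⁻ j∈ , k≡
∈-staircase⁻ a h (suc r) k∈ | inj₂ k∈rest with ∈-staircase⁻ a h r k∈rest
...   | i , j , i<r , j<hi , k≡ = i , j , m≤n⇒m≤1+n i<r , j<hi , k≡

length-staircase : ∀ a h r → length (staircase a h r) ≡ sum (List.map h (downFrom r))
length-staircase a h zero    = refl
length-staircase a h (suc r) = begin
  length (List.map (λ j → r + j * a) (upTo (h r)) ++ staircase a h r)
    ≡⟨ length-++ (List.map (λ j → r + j * a) (upTo (h r))) ⟩
  length (List.map (λ j → r + j * a) (upTo (h r))) + length (staircase a h r)
    ≡⟨ cong₂ _+_ (trans (length-map _ (upTo (h r))) (length-upTo (h r))) (length-staircase a h r) ⟩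
  h r + sum (List.map h (downFrom r))
    ∎
  where open ≡-Reasoning

[i+j*a]%a≡i : ∀ {a} .{{_ : NonZero a}} i j → i < a → (i + j * a) % a ≡ i
[i+j*a]%a≡i {a} i j i<a = trans ([m+kn]%n≡m%n i j a) (m<n⇒m%n≡m i<a)

staircase-unique : ∀ a .{{_ : NonZero a}} h r → r ≤ a → Unique (staircase a h r)
staircase-unique a h zero    _   = []
staircase-unique a h (suc r) r<a =
  ++⁺ (map⁺ row-injective (upTo⁺ (h r))) (staircase-unique a h r (<⇒≤ r<a)) disjoint
  where
  row-injective : ∀ {j j′} → r + j * a ≡ r + j′ * a → j ≡ j′
  row-injective {j} {j′} eq = *-cancelʳ-≡ j j′ a (+-cancelˡ-≡ r (j * a) (j′ * a) eq)
  disjoint : ∀ {k} → ¬ (k ∈ List.map (λ j → r + j * a) (upTo (h r)) × k ∈ staircase a h r)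
  disjoint (k∈row , k∈rest) with ∈-map⁻ (λ j → r + j * a) k∈row | ∈-staircase⁻ a h r k∈rest
  ... | j , _ , refl | i , j′ , i<r , _ , k≡ = <-irrefl r≡i i<r
    where
    r≡i : i ≡ r
    r≡i = begin
      i                  ≡⟨ sym ([i+j*a]%a≡i i j′ (<-trans i<r r<a)) ⟩
      (i + j′ * a) % a   ≡⟨ cong (_% a) (sym k≡) ⟩
      (r + j * a) % a    ≡⟨ [i+j*a]%a≡i r j r<a ⟩
      r                  ∎
      where open ≡-Reasoning

genus : ℕ → ℕ
genus a = sum (List.map (gapCount a) (downFrom a))

sylvesterNumber-gens : ∀ a .{{_ : NonZero a}} → SylvesterNumberIs (gens a) (genus a)
sylvesterNumber-gens a =
  staircase a (gapCount a) a ,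
  staircase-unique a (gapCount a) a ≤-refl ,
  (λ k → mk⇔ (gap⇒nonRepresentable k) (nonRepresentable⇒gap k)) ,
  length-staircase a (gapCount a) a
  where
  gap⇒nonRepresentable : ∀ k → k ∈ staircase a (gapCount a) a → 0 < k × ¬ Representable (gens a) k
  gap⇒nonRepresentable k k∈ with ∈-staircase⁻ a (gapCount a) a k∈
  ... | zero  , _ , _   , ()         , _
  ... | suc _ , _ , i<a , j<gapCount , refl =
    z<s , λ rep → <⇒≱ j<gapCount (representable⇒gapCount≤ a i<a rep)
  nonRepresentable⇒gap : ∀ k → 0 < k × ¬ Representable (gens a) k → k ∈ staircase a (gapCount a) a
  nonRepresentable⇒gap k (_ , ¬rep) = subst (_∈ staircase a (gapCount a) a) (sym k≡)
    (∈-staircase⁺ a (gapCount a) a (m%n<n k a) (≰⇒> λ gapCount≤ →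
      ¬rep (subst (Representable (gens a)) (sym k≡)
        (gapCount≤⇒representable a (k % a) {k / a} (m%n<n k a) gapCount≤))))
    where
    k≡ : k ≡ k % a + k / a * a
    k≡ = m≡m%n+[m/n]*n k a

sum⌈/5⌉ : ℕ → ℕ
sum⌈/5⌉ n = sum (List.map ⌈_/5⌉ (downFrom n))

sum⌈/5⌉-+5 : ∀ n → sum⌈/5⌉ (5 + n) ≡ sum⌈/5⌉ n + (4 + n)
sum⌈/5⌉-+5 n = trans (regroup ⌈ 4 + n /5⌉ ⌈ 3 + n /5⌉ ⌈ 2 + n /5⌉ ⌈ 1 + n /5⌉ ⌈ n /5⌉ (sum⌈/5⌉ n))
                     (cong (sum⌈/5⌉ n +_) (⌈/5⌉-five-consecutive n))
  where
  regroup : ∀ x₄ x₃ x₂ x₁ x₀ s →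
    x₄ + (x₃ + (x₂ + (x₁ + (x₀ + s)))) ≡ s + (x₄ + (x₃ + (x₂ + (x₁ + x₀))))
  regroup = solve-∀

genus-split : ∀ a n →
  sum (List.map (gapCount a) (downFrom (3 + n))) ≡ sum⌈/5⌉ (3 + n) + (⌈ 1 + a /5⌉ + ⌈ 2 + a /5⌉)
genus-split a zero    = regroup ⌈ 1 + a /5⌉ ⌈ 2 + a /5⌉
  where
  regroup : ∀ x y → suc y + (suc x + 0) ≡ 2 + (x + y)
  regroup = solve-∀
genus-split a (suc n) =
  trans (cong (⌈ 3 + n /5⌉ +_) (genus-split a n)) (sym (+-assoc ⌈ 3 + n /5⌉ (sum⌈/5⌉ (3 + n)) _))

genus-+5 : ∀ b → genus (8 + b) ≡ genus (3 + b) + (9 + b)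
genus-+5 b = begin
  genus (8 + b)
    ≡⟨ genus-split (8 + b) (5 + b) ⟩
  sum⌈/5⌉ (8 + b) + (suc ⌈ 4 + b /5⌉ + suc ⌈ 5 + b /5⌉)
    ≡⟨ cong (_+ (suc ⌈ 4 + b /5⌉ + suc ⌈ 5 + b /5⌉)) (sum⌈/5⌉-+5 (3 + b)) ⟩
  sum⌈/5⌉ (3 + b) + (7 + b) + (suc ⌈ 4 + b /5⌉ + suc ⌈ 5 + b /5⌉)
    ≡⟨ regroup (sum⌈/5⌉ (3 + b)) ⌈ 4 + b /5⌉ ⌈ 5 + b /5⌉ b ⟩
  sum⌈/5⌉ (3 + b) + (⌈ 4 + b /5⌉ + ⌈ 5 + b /5⌉) + (9 + b)
    ≡⟨ cong (_+ (9 + b)) (sym (genus-split (3 + b) b)) ⟩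
  genus (3 + b) + (9 + b)
    ∎
  where
  open ≡-Reasoning
  regroup : ∀ s x y b → s + (7 + b) + (suc x + suc y) ≡ s + (x + y) + (9 + b)
  regroup = solve-∀

correction : ℕ → ℕ
correction 0 = 20
correction 1 = 12
correction 2 = 12
correction 3 = 10
correction _ = 16

genus*10 : ∀ b → genus (3 + b) * 10 ≡ (3 + b) * (3 + b) + 7 * (3 + b) + correction ((3 + b) % 5)
genus*10 0 = refl
genus*10 1 = refl
genus*10 2 = refl
genus*10 3 = refl
genus*10 4 = refl
genus*10 (suc (suc (suc (suc (suc b))))) = begin
  genus (8 + b) * 10
    ≡⟨ cong (_* 10) (genus-+5 b) ⟩
  (genus (3 + b) + (9 + b)) * 10
    ≡⟨ *-distribʳ-+ 10 (genus (3 + b)) (9 + b) ⟩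
  genus (3 + b) * 10 + (9 + b) * 10
    ≡⟨ cong (_+ (9 + b) * 10) (genus*10 b) ⟩
  (3 + b) * (3 + b) + 7 * (3 + b) + correction ((3 + b) % 5) + (9 + b) * 10
    ≡⟨ square-step b (correction ((3 + b) % 5)) ⟩
  (8 + b) * (8 + b) + 7 * (8 + b) + correction ((3 + b) % 5)
    ≡⟨ cong (λ r → (8 + b) * (8 + b) + 7 * (8 + b) + correction r) (sym ([8+b]%5≡[3+b]%5 b)) ⟩
  (8 + b) * (8 + b) + 7 * (8 + b) + correction ((8 + b) % 5)
    ∎
  where
  open ≡-Reasoning
  square-step : ∀ b c → (3 + b) * (3 + b) + 7 * (3 + b) + c + (9 + b) * 10 ≡ (8 + b) * (8 + b) + 7 * (8 + b) + c
  square-step = solve-∀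
  [8+b]%5≡[3+b]%5 : ∀ b → (8 + b) % 5 ≡ (3 + b) % 5
  [8+b]%5≡[3+b]%5 b = trans (cong (λ m → (3 + m) % 5) (+-comm 5 b)) ([m+kn]%n≡m%n (3 + b) 1 5)

corollary6 : ∀ (a : ℕ) → 3 ≤ a →
    (a % 5 ≡ 0 → SylvesterNumberIs (a ∷ a + 3 ∷ a + 4 ∷ a + 5 ∷ []) ((a * a + 7 * a + 20) / 10)) ×
    (a % 5 ≡ 1 → SylvesterNumberIs (a ∷ a + 3 ∷ a + 4 ∷ a + 5 ∷ []) ((a * a + 7 * a + 12) / 10)) ×
    (a % 5 ≡ 2 → SylvesterNumberIs (a ∷ a + 3 ∷ a + 4 ∷ a + 5 ∷ []) ((a * a + 7 * a + 12) / 10)) ×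
    (a % 5 ≡ 3 → SylvesterNumberIs (a ∷ a + 3 ∷ a + 4 ∷ a + 5 ∷ []) ((a * a + 7 * a + 10) / 10)) ×
    (a % 5 ≡ 4 → SylvesterNumberIs (a ∷ a + 3 ∷ a + 4 ∷ a + 5 ∷ []) ((a * a + 7 * a + 16) / 10))
corollary6 a (s≤s (s≤s (s≤s (z≤n {b})))) = atResidue , atResidue , atResidue , atResidue , atResidue
  where
  genus≡ : genus a ≡ (a * a + 7 * a + correction (a % 5)) / 10
  genus≡ = trans (sym (m*n/n≡m (genus a) 10)) (cong (_/ 10) (genus*10 b))
  atResidue : ∀ {r} → a % 5 ≡ r → SylvesterNumberIs (gens a) ((a * a + 7 * a + correction r) / 10)
  atResidue refl = subst (SylvesterNumberIs (gens a)) genus≡ (sylvesterNumber-gens a)
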